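{- Let $f$ be an $n$-ary polymorphism of $(\mathbf{LO}_2,\mathbf{LO}_3)$ with $n\ge 7$ and no small 2-sets, and suppose that $f$ does not have a unique pure saturation. Let $t\in[n]$ be such that every pure saturation of $f$ is a recoloured projection with dictating variable $t$. Then there do not exist disjoint non-empty boolean sets $S,T\subseteq[n]$ of $f$ with $f(S)\ne[t\in S]$ and $f(T)\ne[t\in T]$.
   Context: $[n]=\{1,\dots,n\}$; $[t\in S]$ is the Iverson bracket (1 if $t\in S$, else 0). $\mathrm{LO}_3\subseteq\{0,1,2\}^3$ is the set of triples whose maximum entry occurs in exactly one coordinate. Identify $X\subseteq[n]$ with the 0/1 tuple having 1 exactly in positions of $X$. $f:\{0,1\}^n\to\{0,1,2\}$ is a polymorphism of $(\mathbf{LO}_2,\mathbf{LO}_3)$ iff for every ordered partition $(X,Y,Z)$ of $[n]$ into three (possibly empty) parts, $(f(X),f(Y),f(Z))\in\mathrm{LO}_3$. $X$ is an $i$-set if $f(X)=i$, a boolean set if $f(X)\in\{0,1\}$; a small 2-set is a 2-set with at most three elements. For $i\ne f(X)$, $X$ is $i$-recolourable if changing $f$'s value at $X$ alone to $i$ still yields a polymorphism; a boolean $i$-set ($i\in\{0,1\}$) is static if it is not $(1-i)$-recolourable. $f$ is saturated if every superset of a 2-set is a 2-set and for every $X$, $X$ or $[n]\setminus X$ is a 2-set. A saturated $n$-ary polymorphism $g$ is a saturation of $f$ if there is a sequence $f=f_1,\dots,f_l=g$ of $n$-ary polymorphisms where each $f_i$ is obtained from $f_{i-1}$ by changing the value at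 a single boolean set to 2; it is pure if $g$ has no small 2-sets. A polymorphism $h$ is a recoloured projection with dictating variable $t$ if $h(S)=[t\in S]$ for every static boolean set $S$ of $h$. (Such a $t$ as in the hypothesis always exists for $f$ as in the claim.) -}

module Defs where

open import Data.Nat as ℕ using (ℕ; _≤_; _⊔_)
open import Data.Fin using (Fin; zero; suc; toℕ)
open import Data.Bool as Bool using (Bool; true; false; if_then_else_)
open import Data.Vec using (lookup)
open import Data.Vec.Properties using (≡-dec)
open import Data.Fin.Subset using (Subset; ⊥; ⊤; _∩_; _∪_; ∁; _⊆_; ∣_∣; _∈_; Nonempty)
open import Data.Product using (Σ; _×_; ∃; ∃-syntax)
open import Data.Sum using (_⊎_)
open import Relation.Nullary using (¬_; Dec; yes; no)
open import Relation.Nullary.Decidable using (⌊_⌋)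
open import Relation.Binary.PropositionalEquality using (_≡_; _≢_)

-- Values {0,1,2} are Fin 3; an n-ary function {0,1}^n → {0,1,2} is a
-- function on subsets of Fin n (X ↔ its 0/1 characteristic vector).
Fn : ℕ → Set
Fn n = Subset n → Fin 3

private
  b2n : Bool → ℕ
  b2n true  = 1
  b2n false = 0

LO3 : Fin 3 → Fin 3 → Fin 3 → Set
LO3 a b c =
  let m = toℕ a ⊔ toℕ b ⊔ toℕ c in
  b2n ⌊ toℕ a ℕ.≟ m ⌋ ℕ.+ b2n ⌊ toℕ b ℕ.≟ m ⌋ ℕ.+ b2n ⌊ toℕ c ℕ.≟ m ⌋ ≡ 1

IsPartition3 : ∀ {n} → Subset n → Subset n → Subset n → Set
IsPartition3 X Y Z =
  (X ∩ Y ≡ ⊥) × (Y ∩ Z ≡ ⊥) × (X ∩ Z ≡ ⊥) × (X ∪ Y ∪ Z ≡ ⊤)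

IsPolymorphism : ∀ {n} → Fn n → Set
IsPolymorphism {n} f =
  (X Y Z : Subset n) → IsPartition3 X Y Z → LO3 (f X) (f Y) (f Z)

Boolean : ∀ {n} → Fn n → Subset n → Set
Boolean f X = f X ≢ suc (suc zero)

NoSmall2Sets : ∀ {n} → Fn n → Set
NoSmall2Sets {n} f = (X : Subset n) → ¬ (f X ≡ suc (suc zero) × ∣ X ∣ ≤ 3)

update : ∀ {n} → Fn n → Subset n → Fin 3 → Fn n
update f X i Y with ≡-dec Bool._≟_ Y X
... | yes _ = i
... | no  _ = f Y

Static : ∀ {n} → Fn n → Subset n → Set
Static f S =
  (f S ≡ zero × ¬ IsPolymorphism (update f S (suc zero)))
  ⊎ (f S ≡ suc zero × ¬ IsPolymorphism (update f S zero))

Saturated : ∀ {n} → Fn n → Set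
Saturated {n} f =
  ((X Y : Subset n) → X ⊆ Y → f X ≡ suc (suc zero) → f Y ≡ suc (suc zero))
  × ((X : Subset n) → f X ≡ suc (suc zero) ⊎ f (∁ X) ≡ suc (suc zero))

-- A sequence f = f₁, …, f_l = g of n-ary polymorphisms, each obtained from
-- the previous one by changing the value at a single boolean set to 2.
-- (f₁ = f is a polymorphism by assumption; each later f_i is required to be one.)
data SatSeq {n : ℕ} (f : Fn n) (g : Fn n) : Set where
  done : ((X : Subset n) → f X ≡ g X) → SatSeq f g
  step : (X : Subset n) → Boolean f X →
         IsPolymorphism (update f X (suc (suc zero))) →
         SatSeq (update f X (suc (suc zero))) g → SatSeq f g

IsSaturation : ∀ {n} → Fn n → Fn n → Set
IsSaturation f g = IsPolymorphism g × Saturated g × SatSeq f g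

IsPureSaturation : ∀ {n} → Fn n → Fn n → Set
IsPureSaturation f g = IsSaturation f g × NoSmall2Sets g

HasUniquePureSaturation : ∀ {n} → Fn n → Set
HasUniquePureSaturation {n} f =
  Σ (Fn n) λ g → IsPureSaturation f g ×
    ((g' : Fn n) → IsPureSaturation f g' → (X : Subset n) → g' X ≡ g X)

iv : ∀ {n} → Fin n → Subset n → Fin 3
iv t S = if lookup S t then suc zero else zero

RecolouredProjection : ∀ {n} → Fn n → Fin n → Set
RecolouredProjection {n} h t = (S : Subset n) → Static h S → h S ≡ iv t S

-- Pure saturations of f are the colourings that turn a maximal intersecting family containing
-- the Base sets (the 2-sets of f and the sets with at most three-element complement; n ≥ 7
-- makes this family intersecting) into 2-sets. If no set U has both U and ∁ U light (no
-- 2-subset, complement of size at least 4), every such family is the up-closure of Base, so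
-- the pure saturation is unique. Otherwise, for a light split W, every nonempty P inside W or
-- ∁ W extends to a partition (P, Q, R) into light sets; adding ∁ P, ∁ Q, ∁ R to Base yields a
-- pure saturation in which P is static, hence f P = [t ∈ P]. Now either T lies inside W or
-- ∁ W, or S, W ∖ S and ∁ W ∖ S partition [n], and LO₃ transfers the agreement to S.

module Submission where

open import Defs
open import Data.Bool as Bool using (true; false)
open import Data.Empty using (⊥-elim)
open import Data.Fin using (Fin; zero; suc; fromℕ<) renaming (_≟_ to _≟ᶠ_)
open import Data.Fin.Subset
  using (Subset; ⊥; ⊤; _∩_; _∪_; ∁; _∈_; _∉_; _⊆_; ∣_∣; Nonempty; ⁅_⁆)
open import Data.Fin.Subset.Properties
  using ( _∈?_; _⊆?_; ⊆-refl; ⊆-trans; ⊆-antisym; ⊥⊆; ∉⊥; ∈⊤; p⊆q⇒∣p∣≤∣q∣; p⊆q⇒∁p⊇∁q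
        ; x∈p⇒x∉∁p; x∈∁p⇒x∉p; x∉∁p⇒x∈p; x∉p⇒x∈∁p; p∪∁p≡⊤; ∣∁p∣≡n∸∣p∣; ∣p∣≤n
        ; x∈p∩q⁺; x∈p∩q⁻; p∩q⊆p; p⊆p∪q; x∈p∪q⁺; x∈p∪q⁻; ∪-assoc
        ; x∈⁅x⁆; x∈⁅y⁆⇒x≡y; ∣⁅x⁆∣≡1; ∣⊥∣≡0; nonempty?; anySubset? )
open import Data.List using (List; []; _∷_; map; _++_)
open import Data.List.Membership.Propositional using () renaming (_∈_ to _∈ˡ_)
open import Data.List.Membership.Propositional.Properties using (∈-++⁺ˡ; ∈-++⁺ʳ; ∈-map⁺)
open import Data.List.Relation.Unary.Any using (here; there)
open import Data.Nat as ℕ using (ℕ; _≤_; _+_; _≤?_; s≤s; z≤n)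
open import Data.Nat.Properties using (≤-trans; +-mono-≤; m+[n∸m]≡n; ≤⇒≯; ≰⇒>)
open import Data.Product using (Σ; ∃; _×_; _,_; proj₁; proj₂)
open import Data.Sum using (_⊎_; inj₁; inj₂; [_,_]′)
open import Data.Vec using ([]; _∷_; lookup)
open import Data.Vec.Properties using (≡-dec; []=⇒lookup; lookup⇒[]=)
open import Function using (_∘_)
open import Relation.Nullary using (¬_; Dec; yes; no; contradiction)
open import Relation.Nullary.Decidable using (_×-dec_; _⊎-dec_; ¬?; decidable-stable)
open import Relation.Unary using (Decidable)
open import Relation.Binary.PropositionalEquality
  using (_≡_; _≢_; refl; sym; trans; cong; subst; subst₂)

private
  variable
    n : ℕ
    i : Fin n
    A B P Q R S T U W X Y Z : Subset n

pattern one = suc zero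
pattern two = suc (suc zero)

data Bit : Fin 3 → Set where
  0ᵇ : Bit zero
  1ᵇ : Bit one

bit : ∀ {a} → a ≢ two → Bit a
bit {zero} _   = 0ᵇ
bit {one}  _   = 1ᵇ
bit {two} a≢2 = ⊥-elim (a≢2 refl)

LO3-cong : ∀ {a a′ b b′ c c′} → a ≡ a′ → b ≡ b′ → c ≡ c′ → LO3 a b c → LO3 a′ b′ c′
LO3-cong refl refl refl lo3 = lo3

LO3-2-2 : ∀ c → ¬ LO3 two two c
LO3-2-2 zero ()
LO3-2-2 one  ()
LO3-2-2 two  ()

LO3-single-2 : ∀ {b c} → Bit b → Bit c → LO3 two b c × LO3 b two c × LO3 b c two
LO3-single-2 0ᵇ 0ᵇ = refl , refl , refl
LO3-single-2 0ᵇ 1ᵇ = refl , refl , refl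
LO3-single-2 1ᵇ 0ᵇ = refl , refl , refl
LO3-single-2 1ᵇ 1ᵇ = refl , refl , refl

LO3-unique : ∀ {a a′ b c} → Bit a → Bit a′ → Bit b → Bit c → LO3 a b c → LO3 a′ b c → a ≡ a′
LO3-unique 0ᵇ 0ᵇ _  _  _  _  = refl
LO3-unique 1ᵇ 1ᵇ _  _  _  _  = refl
LO3-unique 0ᵇ 1ᵇ 0ᵇ 0ᵇ ()  _
LO3-unique 0ᵇ 1ᵇ 0ᵇ 1ᵇ _  ()
LO3-unique 0ᵇ 1ᵇ 1ᵇ 0ᵇ _  ()
LO3-unique 0ᵇ 1ᵇ 1ᵇ 1ᵇ ()  _
LO3-unique 1ᵇ 0ᵇ 0ᵇ 0ᵇ _  ()
LO3-unique 1ᵇ 0ᵇ 0ᵇ 1ᵇ ()  _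
LO3-unique 1ᵇ 0ᵇ 1ᵇ 0ᵇ ()  _
LO3-unique 1ᵇ 0ᵇ 1ᵇ 1ᵇ _  ()

Disjoint : Subset n → Subset n → Set
Disjoint A B = ∀ {i} → i ∈ A → i ∉ B

Intersecting : (Subset n → Set) → Set
Intersecting {n} 𝒜 = ∀ {A B : Subset n} → 𝒜 A → 𝒜 B → ¬ Disjoint A B

Disjoint-sym : Disjoint A B → Disjoint B A
Disjoint-sym A⊥B i∈B i∈A = A⊥B i∈A i∈B

Disjoint-∁ : Disjoint A (∁ A)
Disjoint-∁ = x∈p⇒x∉∁p

Disjoint⇒⊆∁ : Disjoint A B → A ⊆ ∁ B
Disjoint⇒⊆∁ A⊥B = x∉p⇒x∈∁p ∘ A⊥B

Disjoint-∩∁ : Disjoint A (B ∩ ∁ A)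
Disjoint-∩∁ {A = A} {B} i∈A i∈B∩∁A = x∈∁p⇒x∉p (proj₂ (x∈p∩q⁻ B (∁ A) i∈B∩∁A)) i∈A

∩≡⊥⇒Disjoint : A ∩ B ≡ ⊥ → Disjoint A B
∩≡⊥⇒Disjoint A∩B≡⊥ i∈A i∈B = ∉⊥ (subst (_ ∈_) A∩B≡⊥ (x∈p∩q⁺ (i∈A , i∈B)))

Disjoint⇒∩≡⊥ : Disjoint A B → A ∩ B ≡ ⊥
Disjoint⇒∩≡⊥ {A = A} {B} A⊥B =
  ⊆-antisym (λ i∈A∩B → let i∈A , i∈B = x∈p∩q⁻ A B i∈A∩B in ⊥-elim (A⊥B i∈A i∈B)) ⊥⊆

∁-involutive : ∁ (∁ A) ≡ A
∁-involutive = ⊆-antisym (x∉∁p⇒x∈p ∘ x∈∁p⇒x∉p) (x∉p⇒x∈∁p ∘ x∈p⇒x∉∁p)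

∣A∣+∣∁A∣≡n : (A : Subset n) → ∣ A ∣ + ∣ ∁ A ∣ ≡ n
∣A∣+∣∁A∣≡n A = trans (cong (∣ A ∣ +_) (∣∁p∣≡n∸∣p∣ A)) (m+[n∸m]≡n (∣p∣≤n A))

∈∁∪⁺ : i ∉ A → i ∉ B → i ∈ ∁ (A ∪ B)
∈∁∪⁺ {A = A} {B} i∉A i∉B = x∉p⇒x∈∁p λ i∈A∪B → [ i∉A , i∉B ]′ (x∈p∪q⁻ A B i∈A∪B)

∈∁∪⁻ : i ∈ ∁ (A ∪ B) → i ∉ A × i ∉ B
∈∁∪⁻ i∈∁A∪B = (λ i∈A → x∈∁p⇒x∉p i∈∁A∪B (x∈p∪q⁺ (inj₁ i∈A)))
            , (λ i∈B → x∈∁p⇒x∉p i∈∁A∪B (x∈p∪q⁺ (inj₂ i∈B)))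

size≥1⇒Nonempty : (A : Subset n) → 1 ≤ ∣ A ∣ → Nonempty A
size≥1⇒Nonempty {n} A 1≤∣A∣ with nonempty? A
... | yes A≠∅ = A≠∅
... | no A≡∅ = ⊥-elim (≤⇒≯ (subst (∣ A ∣ ≤_) (∣⊥∣≡0 n) (p⊆q⇒∣p∣≤∣q∣ A⊆⊥)) 1≤∣A∣)
  where
  A⊆⊥ : A ⊆ ⊥
  A⊆⊥ i∈A = ⊥-elim (A≡∅ (_ , i∈A))

partition-∁∪ : Disjoint A B → IsPartition3 A B (∁ (A ∪ B))
partition-∁∪ {A = A} {B} A⊥B =
    Disjoint⇒∩≡⊥ A⊥B
  , Disjoint⇒∩≡⊥ (λ i∈B i∈C → proj₂ (∈∁∪⁻ i∈C) i∈B)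
  , Disjoint⇒∩≡⊥ (λ i∈A i∈C → proj₁ (∈∁∪⁻ i∈C) i∈A)
  , trans (sym (∪-assoc A B (∁ (A ∪ B)))) (p∪∁p≡⊤ (A ∪ B))

partition-disjoint : IsPartition3 X Y Z → Disjoint X Y × Disjoint Y Z × Disjoint X Z
partition-disjoint (X∩Y≡⊥ , Y∩Z≡⊥ , X∩Z≡⊥ , _) =
  ∩≡⊥⇒Disjoint X∩Y≡⊥ , ∩≡⊥⇒Disjoint Y∩Z≡⊥ , ∩≡⊥⇒Disjoint X∩Z≡⊥

partition-cover : IsPartition3 X Y Z → ∀ i → i ∈ X ⊎ i ∈ Y ⊎ i ∈ Z
partition-cover {X = X} {Y} {Z} (_ , _ , _ , X∪Y∪Z≡⊤) i
  with x∈p∪q⁻ X (Y ∪ Z) (subst (i ∈_) (sym X∪Y∪Z≡⊤) ∈⊤)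
... | inj₁ i∈X   = inj₁ i∈X
... | inj₂ i∈Y∪Z = inj₂ (x∈p∪q⁻ Y Z i∈Y∪Z)

CoParts : Subset n → Subset n → Subset n → Subset n → Set
CoParts P Q R A = A ≡ ∁ P ⊎ A ≡ ∁ Q ⊎ A ≡ ∁ R

CoParts-intersecting : IsPartition3 P Q R → Nonempty P → Nonempty Q → Nonempty R →
  Intersecting (CoParts P Q R)
CoParts-intersecting {P = P} {Q} {R} part (p , p∈P) (q , q∈Q) (r , r∈R) = meet
  where
  P⊥Q = proj₁ (partition-disjoint part)
  Q⊥R = proj₁ (proj₂ (partition-disjoint part))
  P⊥R = proj₂ (proj₂ (partition-disjoint part))

  p∈∁Q = Disjoint⇒⊆∁ P⊥Q p∈P
  p∈∁R = Disjoint⇒⊆∁ P⊥R p∈P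
  q∈∁P = Disjoint⇒⊆∁ (Disjoint-sym P⊥Q) q∈Q
  q∈∁R = Disjoint⇒⊆∁ Q⊥R q∈Q
  r∈∁P = Disjoint⇒⊆∁ (Disjoint-sym P⊥R) r∈R
  r∈∁Q = Disjoint⇒⊆∁ (Disjoint-sym Q⊥R) r∈R

  meet : Intersecting (CoParts P Q R)
  meet (inj₁ refl)        (inj₁ refl)        A⊥B = A⊥B q∈∁P q∈∁P
  meet (inj₁ refl)        (inj₂ (inj₁ refl)) A⊥B = A⊥B r∈∁P r∈∁Q
  meet (inj₁ refl)        (inj₂ (inj₂ refl)) A⊥B = A⊥B q∈∁P q∈∁R
  meet (inj₂ (inj₁ refl)) (inj₁ refl)        A⊥B = A⊥B r∈∁Q r∈∁P
  meet (inj₂ (inj₁ refl)) (inj₂ (inj₁ refl)) A⊥B = A⊥B p∈∁Q p∈∁Q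
  meet (inj₂ (inj₁ refl)) (inj₂ (inj₂ refl)) A⊥B = A⊥B p∈∁Q p∈∁R
  meet (inj₂ (inj₂ refl)) (inj₁ refl)        A⊥B = A⊥B q∈∁R q∈∁P
  meet (inj₂ (inj₂ refl)) (inj₂ (inj₁ refl)) A⊥B = A⊥B p∈∁R p∈∁Q
  meet (inj₂ (inj₂ refl)) (inj₂ (inj₂ refl)) A⊥B = A⊥B p∈∁R p∈∁R

polymorphism-2sets-intersecting : ∀ {h : Fn n} → IsPolymorphism h → Intersecting (λ X → h X ≡ two)
polymorphism-2sets-intersecting {h = h} hP {A} {B} hA≡2 hB≡2 A⊥B =
  LO3-2-2 (h C) (subst₂ (λ a b → LO3 a b (h C)) hA≡2 hB≡2 (hP A B C (partition-∁∪ A⊥B)))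
  where C = ∁ (A ∪ B)

polymorphism-from-2sets : ∀ {f h : Fn n} → IsPolymorphism f →
  (∀ X → h X ≢ two → h X ≡ f X) → Intersecting (λ X → h X ≡ two) → IsPolymorphism h
polymorphism-from-2sets {f = f} {h} fP off-2 2sets-meet X Y Z part
  with partition-disjoint part | h X ≟ᶠ two | h Y ≟ᶠ two | h Z ≟ᶠ two
... | X⊥Y , _ , _   | yes hX | yes hY | _      = ⊥-elim (2sets-meet hX hY X⊥Y)
... | _ , _ , X⊥Z   | yes hX | _      | yes hZ = ⊥-elim (2sets-meet hX hZ X⊥Z)
... | _ , Y⊥Z , _   | _      | yes hY | yes hZ = ⊥-elim (2sets-meet hY hZ Y⊥Z)
... | _ | yes hX | no hY | no hZ =
  subst (λ a → LO3 a (h Y) (h Z)) (sym hX) (proj₁ (LO3-single-2 (bit hY) (bit hZ)))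
... | _ | no hX | yes hY | no hZ =
  subst (λ b → LO3 (h X) b (h Z)) (sym hY) (proj₁ (proj₂ (LO3-single-2 (bit hX) (bit hZ))))
... | _ | no hX | no hY | yes hZ =
  subst (λ c → LO3 (h X) (h Y) c) (sym hZ) (proj₂ (proj₂ (LO3-single-2 (bit hX) (bit hY))))
... | _ | no hX | no hY | no hZ =
  LO3-cong (sym (off-2 X hX)) (sym (off-2 Y hY)) (sym (off-2 Z hZ)) (fP X Y Z part)

iv-∈ : ∀ {t : Fin n} → t ∈ S → iv t S ≡ one
iv-∈ t∈S rewrite []=⇒lookup t∈S = refl

iv-∉ : ∀ {t : Fin n} → t ∉ S → iv t S ≡ zero
iv-∉ {S = S} {t} t∉S with lookup S t in eq
... | true  = ⊥-elim (t∉S (lookup⇒[]= t S eq))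
... | false = refl

iv-bit : (t : Fin n) (S : Subset n) → Bit (iv t S)
iv-bit t S with lookup S t
... | true  = 1ᵇ
... | false = 0ᵇ

iv-polymorphism : (t : Fin n) → IsPolymorphism (iv t)
iv-polymorphism t X Y Z part with partition-disjoint part | partition-cover part t
... | X⊥Y , _ , X⊥Z | inj₁ t∈X
  rewrite iv-∈ t∈X | iv-∉ (X⊥Y t∈X) | iv-∉ (X⊥Z t∈X) = refl
... | X⊥Y , Y⊥Z , _ | inj₂ (inj₁ t∈Y)
  rewrite iv-∉ (Disjoint-sym X⊥Y t∈Y) | iv-∈ t∈Y | iv-∉ (Y⊥Z t∈Y) = refl
... | _ , Y⊥Z , X⊥Z | inj₂ (inj₂ t∈Z)
  rewrite iv-∉ (Disjoint-sym X⊥Z t∈Z) | iv-∉ (Disjoint-sym Y⊥Z t∈Z) | iv-∈ t∈Z = refl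

_≟ˢ_ : (X Y : Subset n) → Dec (X ≡ Y)
_≟ˢ_ = ≡-dec Bool._≟_

update-same : ∀ (h : Fn n) X a → update h X a X ≡ a
update-same h X a with ≡-dec Bool._≟_ X X
... | yes _   = refl
... | no X≢X = contradiction refl X≢X

update-other : ∀ (h : Fn n) X a → Y ≢ X → update h X a Y ≡ h Y
update-other {Y = Y} h X a Y≢X with ≡-dec Bool._≟_ Y X
... | yes Y≡X = contradiction Y≡X Y≢X
... | no _    = refl

Nonempty-Disjoint⇒≢ : Nonempty Y → Disjoint X Y → Y ≢ X
Nonempty-Disjoint⇒≢ (_ , i∈Y) X⊥Y refl = X⊥Y i∈Y i∈Y

-- Recolouring X to the other boolean value would violate LO₃ on the partition.
static-of-partition : ∀ {h : Fn n} → IsPolymorphism h → IsPartition3 X Y Z →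
  Nonempty Y → Nonempty Z → Bit (h X) → Bit (h Y) → Bit (h Z) → Static h X
static-of-partition {X = X} {Y} {Z} {h} hP part Y≠∅ Z≠∅ bX bY bZ = static bX refl
  where
  X⊥Y = proj₁ (partition-disjoint part)
  X⊥Z = proj₂ (proj₂ (partition-disjoint part))

  recoloured : ∀ a → IsPolymorphism (update h X a) → LO3 a (h Y) (h Z)
  recoloured a hP′ =
    LO3-cong (update-same h X a) (update-other h X a (Nonempty-Disjoint⇒≢ Y≠∅ X⊥Y))
             (update-other h X a (Nonempty-Disjoint⇒≢ Z≠∅ X⊥Z)) (hP′ X Y Z part)

  current : ∀ {a} → h X ≡ a → LO3 a (h Y) (h Z)
  current hX≡a = subst (λ a → LO3 a (h Y) (h Z)) hX≡a (hP X Y Z part)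

  static : ∀ {a} → Bit a → h X ≡ a → Static h X
  static 0ᵇ hX≡0 = inj₁ (hX≡0 , λ hP′ →
    contradiction (LO3-unique 0ᵇ 1ᵇ bY bZ (current hX≡0) (recoloured one hP′)) λ ())
  static 1ᵇ hX≡1 = inj₂ (hX≡1 , λ hP′ →
    contradiction (LO3-unique 1ᵇ 0ᵇ bY bZ (current hX≡1) (recoloured zero hP′)) λ ())

record _⊑_ (f g : Fn n) : Set where
  field
    keeps-2      : ∀ X → f X ≡ two → g X ≡ two
    agrees-off-2 : ∀ X → g X ≢ two → g X ≡ f X

open _⊑_

⊑-refl : ∀ {f : Fn n} → f ⊑ f
⊑-refl = record { keeps-2 = λ _ fX → fX ; agrees-off-2 = λ _ _ → refl }

⊑-trans : ∀ {f g h : Fn n} → f ⊑ g → g ⊑ h → f ⊑ h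
⊑-trans f⊑g g⊑h = record
  { keeps-2      = λ X → keeps-2 g⊑h X ∘ keeps-2 f⊑g X
  ; agrees-off-2 = λ X hX≢2 → let hX≡gX = agrees-off-2 g⊑h X hX≢2 in
      trans hX≡gX (agrees-off-2 f⊑g X (hX≢2 ∘ trans hX≡gX))
  }

≗⇒⊑ : ∀ {f g : Fn n} → (∀ X → f X ≡ g X) → f ⊑ g
≗⇒⊑ f≗g = record
  { keeps-2 = λ X fX → trans (sym (f≗g X)) fX ; agrees-off-2 = λ X _ → sym (f≗g X) }

⊑-update : ∀ (h : Fn n) X → h ⊑ update h X two
⊑-update h X = record { keeps-2 = keeps ; agrees-off-2 = agrees }
  where
  keeps : ∀ Y → h Y ≡ two → update h X two Y ≡ two
  keeps Y hY with ≡-dec Bool._≟_ Y X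
  ... | yes _ = refl
  ... | no  _ = hY

  agrees : ∀ Y → update h X two Y ≢ two → update h X two Y ≡ h Y
  agrees Y h′Y≢2 with ≡-dec Bool._≟_ Y X
  ... | yes _ = contradiction refl h′Y≢2
  ... | no  _ = refl

SatSeq⇒⊑ : ∀ {f g : Fn n} → SatSeq f g → f ⊑ g
SatSeq⇒⊑ (done f≗g)       = ≗⇒⊑ f≗g
SatSeq⇒⊑ (step X _ _ seq) = ⊑-trans (⊑-update _ X) (SatSeq⇒⊑ seq)

⊑-polymorphism : ∀ {f g h : Fn n} → IsPolymorphism f → IsPolymorphism g →
  f ⊑ h → h ⊑ g → IsPolymorphism h
⊑-polymorphism fP gP f⊑h h⊑g = polymorphism-from-2sets fP (agrees-off-2 f⊑h) λ hA hB →
  polymorphism-2sets-intersecting gP (keeps-2 h⊑g _ hA) (keeps-2 h⊑g _ hB)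

subsets : ∀ n → List (Subset n)
subsets ℕ.zero    = [] ∷ []
subsets (ℕ.suc n) = map (true ∷_) (subsets n) ++ map (false ∷_) (subsets n)

∈-subsets : (X : Subset n) → X ∈ˡ subsets n
∈-subsets []                    = here refl
∈-subsets {ℕ.suc n} (true  ∷ X) = ∈-++⁺ˡ (∈-map⁺ (true ∷_) (∈-subsets X))
∈-subsets {ℕ.suc n} (false ∷ X) =
  ∈-++⁺ʳ (map (true ∷_) (subsets n)) (∈-map⁺ (false ∷_) (∈-subsets X))

-- Recolour, one subset at a time, every set on which the current function still differs from g.
⊑⇒SatSeq : ∀ {f g : Fn n} → IsPolymorphism f → IsPolymorphism g → f ⊑ g → SatSeq f g
⊑⇒SatSeq {n} {f} {g} fP gP f⊑g = go (subsets n) f ⊑-refl f⊑g (λ X _ → ∈-subsets X)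
  where
  Differ : Fn n → List (Subset n) → Set
  Differ h L = ∀ Y → h Y ≢ g Y → Y ∈ˡ L

  shrink : ∀ {h h′ X L} → Differ h (X ∷ L) → h′ X ≡ g X → (∀ Y → Y ≢ X → h′ Y ≡ h Y) → Differ h′ L
  shrink {h} {h′} {X} diff h′X≡gX h′≗h Y h′Y≢gY with diff Y (h′Y≢gY ∘ trans (h′≗h Y Y≢X))
    where
    Y≢X : Y ≢ X
    Y≢X refl = h′Y≢gY h′X≡gX
  ... | here refl = contradiction h′X≡gX h′Y≢gY
  ... | there Y∈L = Y∈L

  go : ∀ L h → f ⊑ h → h ⊑ g → Differ h L → SatSeq h g
  go [] h _ _ diff =
    done λ X → decidable-stable (h X ≟ᶠ g X) λ hX≢gX → contradiction (diff X hX≢gX) λ ()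
  go (X ∷ L) h f⊑h h⊑g diff with h X ≟ᶠ g X
  ... | yes hX≡gX = go L h f⊑h h⊑g (shrink diff hX≡gX λ _ _ → refl)
  ... | no hX≢gX  = step X hX≢2 (⊑-polymorphism fP gP f⊑h′ h′⊑g)
                      (go L h′ f⊑h′ h′⊑g (shrink diff h′X≡gX λ Y → update-other h X two))
    where
    h′ = update h X two
    gX≡2 : g X ≡ two
    gX≡2 = decidable-stable (g X ≟ᶠ two) λ gX≢2 → hX≢gX (sym (agrees-off-2 h⊑g X gX≢2))
    hX≢2 : h X ≢ two
    hX≢2 hX≡2 = hX≢gX (trans hX≡2 (sym gX≡2))
    h′X≡gX : h′ X ≡ g X
    h′X≡gX = trans (update-same h X two) (sym gX≡2)
    f⊑h′ : f ⊑ h′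
    f⊑h′ = ⊑-trans f⊑h (⊑-update h X)
    h′⊑g : h′ ⊑ g
    h′⊑g = record { keeps-2 = keeps ; agrees-off-2 = agrees }
      where
      keeps : ∀ Y → h′ Y ≡ two → g Y ≡ two
      keeps Y h′Y with X ≟ˢ Y
      ... | yes refl = gX≡2
      ... | no X≢Y   = keeps-2 h⊑g Y (trans (sym (update-other h X two (X≢Y ∘ sym))) h′Y)
      agrees : ∀ Y → g Y ≢ two → g Y ≡ h′ Y
      agrees Y gY≢2 with X ≟ˢ Y
      ... | yes refl = contradiction gX≡2 gY≢2
      ... | no X≢Y   = trans (agrees-off-2 h⊑g Y gY≢2) (sym (update-other h X two (X≢Y ∘ sym)))

-- Light sets and the sets every pure saturation must colour 2.

Free : Fn n → Subset n → Set
Free f X = ¬ ∃ λ Y → Y ⊆ X × f Y ≡ two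

Light : Fn n → Subset n → Set
Light f X = Free f X × 4 ≤ ∣ ∁ X ∣

LightSplit : Fn n → Subset n → Set
LightSplit f U = Light f U × Light f (∁ U)

Base : Fn n → Subset n → Set
Base f X = f X ≡ two ⊎ ∣ ∁ X ∣ ≤ 3

Light? : (f : Fn n) → Decidable (Light f)
Light? f X = ¬? (anySubset? λ Y → Y ⊆? X ×-dec f Y ≟ᶠ two) ×-dec 4 ≤? ∣ ∁ X ∣

LightSplit? : (f : Fn n) → Decidable (LightSplit f)
LightSplit? f U = Light? f U ×-dec Light? f (∁ U)

Base? : (f : Fn n) → Decidable (Base f)
Base? f X = f X ≟ᶠ two ⊎-dec ∣ ∁ X ∣ ≤? 3

Light-⊆ : ∀ {f : Fn n} → X ⊆ Y → Light f Y → Light f X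
Light-⊆ X⊆Y (free , large) =
    (λ (Z , Z⊆X , fZ) → free (Z , ⊆-trans Z⊆X X⊆Y , fZ))
  , ≤-trans large (p⊆q⇒∣p∣≤∣q∣ (p⊆q⇒∁p⊇∁q X⊆Y))

Light⇒Nonempty-∁ : ∀ {f : Fn n} → Light f X → Nonempty (∁ X)
Light⇒Nonempty-∁ {X = X} (_ , large) = size≥1⇒Nonempty (∁ X) (≤-trans (s≤s z≤n) large)

LightSplit-∁ : ∀ {f : Fn n} → LightSplit f U → LightSplit f (∁ U)
LightSplit-∁ {f = f} (light , light∁) = light∁ , subst (Light f) (sym ∁-involutive) light

Light-∁-meets-Base : ∀ {f : Fn n} → Light f X → Base f B → ¬ Disjoint (∁ X) B
Light-∁-meets-Base {X = X} {B} (free , _) (inj₁ fB) ∁X⊥B = free (B , B⊆X , fB)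
  where
  B⊆X : B ⊆ X
  B⊆X i∈B = x∉∁p⇒x∈p λ i∈∁X → ∁X⊥B i∈∁X i∈B
Light-∁-meets-Base (_ , large) (inj₂ small) ∁X⊥B =
  ≤⇒≯ (≤-trans (p⊆q⇒∣p∣≤∣q∣ (Disjoint⇒⊆∁ ∁X⊥B)) small) large

Base⇒2 : ∀ {f g : Fn n} → IsPureSaturation f g → Base f X → g X ≡ two
Base⇒2 ((_ , _ , seq) , _) (inj₁ fX) = keeps-2 (SatSeq⇒⊑ seq) _ fX
Base⇒2 {X = X} ((_ , (_ , X⊎∁X) , _) , noSmall) (inj₂ small) with X⊎∁X X
... | inj₁ gX  = gX
... | inj₂ g∁X = ⊥-elim (noSmall (∁ X) (g∁X , small))

-- Pure saturations from maximal intersecting families.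

module Saturate {f : Fn n} (fP : IsPolymorphism f)
  {Big : Subset n → Set} (Big? : Decidable Big) (Big-intersecting : Intersecting Big)
  (Big-maximal : ∀ X → ¬ Big X → Big (∁ X)) (Base⊆Big : ∀ {X} → Base f X → Big X) where

  g : Fn n
  g X with Big? X
  ... | yes _ = two
  ... | no  _ = f X

  g-Big : Big X → g X ≡ two
  g-Big {X} big with Big? X
  ... | yes _    = refl
  ... | no ¬big = contradiction big ¬big

  g-¬Big : ¬ Big X → g X ≡ f X
  g-¬Big {X} ¬big with Big? X
  ... | yes big = contradiction big ¬big
  ... | no  _   = refl

  g≡2⇒Big : g X ≡ two → Big X
  g≡2⇒Big {X} gX with Big? X
  ... | yes big = big
  ... | no  _   = Base⊆Big (inj₁ gX)

  f⊑g : f ⊑ g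
  f⊑g = record
    { keeps-2      = λ X fX → g-Big (Base⊆Big (inj₁ fX))
    ; agrees-off-2 = λ X gX≢2 → g-¬Big (gX≢2 ∘ g-Big)
    }

  g-polymorphism : IsPolymorphism g
  g-polymorphism = polymorphism-from-2sets fP (agrees-off-2 f⊑g) λ gA gB →
    Big-intersecting (g≡2⇒Big gA) (g≡2⇒Big gB)

  g-saturated : Saturated g
  g-saturated = upward , X⊎∁X
    where
    upward : ∀ X Y → X ⊆ Y → g X ≡ two → g Y ≡ two
    upward X Y X⊆Y gX with Big? Y
    ... | yes _   = refl
    ... | no ¬big = ⊥-elim (Big-intersecting (g≡2⇒Big gX) (Big-maximal Y ¬big) (Disjoint-∁ ∘ X⊆Y))
    X⊎∁X : ∀ X → g X ≡ two ⊎ g (∁ X) ≡ two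
    X⊎∁X X with Big? X
    ... | yes _   = inj₁ refl
    ... | no ¬big = inj₂ (g-Big (Big-maximal X ¬big))

  g-noSmall : NoSmall2Sets g
  g-noSmall X (gX , ∣X∣≤3) = Big-intersecting (g≡2⇒Big gX) (Base⊆Big (inj₂ ∣∁∁X∣≤3)) Disjoint-∁
    where
    ∣∁∁X∣≤3 : ∣ ∁ (∁ X) ∣ ≤ 3
    ∣∁∁X∣≤3 = subst (λ Y → ∣ Y ∣ ≤ 3) (sym (∁-involutive {A = X})) ∣X∣≤3

  g-pure : IsPureSaturation f g
  g-pure = (g-polymorphism , g-saturated , ⊑⇒SatSeq fP g-polymorphism f⊑g) , g-noSmall

  g-unique : (∀ g′ → IsPureSaturation f g′ → ∀ {X} → Big X → g′ X ≡ two) →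
    HasUniquePureSaturation f
  g-unique Big⇒2 = g , g-pure , agrees
    where
    agrees : ∀ g′ → IsPureSaturation f g′ → ∀ X → g′ X ≡ g X
    agrees g′ pure@((g′P , _ , seq) , _) X with Big? X
    ... | yes big = Big⇒2 g′ pure big
    ... | no ¬big = agrees-off-2 (SatSeq⇒⊑ seq) X g′X≢2
      where
      g′X≢2 : g′ X ≢ two
      g′X≢2 g′X = polymorphism-2sets-intersecting {h = g′} g′P g′X
        (Big⇒2 g′ pure (Big-maximal X ¬big)) (Disjoint-∁ {A = X})

module UpClosure {f : Fn n} (fP : IsPolymorphism f)
  {G : Subset n → Set} (G? : Decidable G) (G-intersecting : Intersecting G)
  (Base⊆G : ∀ {X} → Base f X → G X) (t : Fin n) where

  Up : Subset n → Set
  Up X = ∃ λ Y → G Y × Y ⊆ X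

  Up? : Decidable Up
  Up? X = anySubset? λ Y → G? Y ×-dec Y ⊆? X

  Big : Subset n → Set
  Big X = Up X ⊎ (¬ Up (∁ X) × t ∈ X)

  Big? : Decidable Big
  Big? X = Up? X ⊎-dec (¬? (Up? (∁ X)) ×-dec t ∈? X)

  Big-intersecting : Intersecting Big
  Big-intersecting (inj₁ (A′ , GA′ , A′⊆A)) (inj₁ (B′ , GB′ , B′⊆B)) A⊥B =
    G-intersecting GA′ GB′ λ i∈A′ i∈B′ → A⊥B (A′⊆A i∈A′) (B′⊆B i∈B′)
  Big-intersecting (inj₁ (A′ , GA′ , A′⊆A)) (inj₂ (¬Up∁B , _)) A⊥B =
    ¬Up∁B (A′ , GA′ , Disjoint⇒⊆∁ A⊥B ∘ A′⊆A)
  Big-intersecting (inj₂ (¬Up∁A , _)) (inj₁ (B′ , GB′ , B′⊆B)) A⊥B =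
    ¬Up∁A (B′ , GB′ , Disjoint⇒⊆∁ (Disjoint-sym A⊥B) ∘ B′⊆B)
  Big-intersecting (inj₂ (_ , t∈A)) (inj₂ (_ , t∈B)) A⊥B = A⊥B t∈A t∈B

  Big-maximal : ∀ X → ¬ Big X → Big (∁ X)
  Big-maximal X ¬big with Up? (∁ X)
  ... | yes Up∁X = inj₁ Up∁X
  ... | no ¬Up∁X = inj₂ ( ¬big ∘ inj₁ ∘ subst Up ∁-involutive
                        , x∉p⇒x∈∁p λ t∈X → ¬big (inj₂ (¬Up∁X , t∈X)) )

  open Saturate fP Big? Big-intersecting Big-maximal (λ base → inj₁ (_ , Base⊆G base , ⊆-refl)) public

  ¬Up⇒Light : ¬ Up X → Light f X
  ¬Up⇒Light {X} ¬up =
      (λ (Y , Y⊆X , fY) → ¬up (Y , Base⊆G (inj₁ fY) , Y⊆X))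
    , ≰⇒> λ small → ¬up (X , Base⊆G (inj₂ small) , ⊆-refl)

  Big⇒Up⊎LightSplit : Big X → Up X ⊎ LightSplit f X
  Big⇒Up⊎LightSplit (inj₁ up) = inj₁ up
  Big⇒Up⊎LightSplit {X} (inj₂ (¬Up∁X , _)) with Up? X
  ... | yes up = inj₁ up
  ... | no ¬up = inj₂ (¬Up⇒Light ¬up , ¬Up⇒Light ¬Up∁X)

module _ (n≥7 : 7 ≤ n) {f : Fn n} (fP : IsPolymorphism f) (noSmall : NoSmall2Sets f) where

  Base-intersecting : Intersecting (Base f)
  Base-intersecting (inj₁ fA) (inj₁ fB) A⊥B = polymorphism-2sets-intersecting {h = f} fP fA fB A⊥B
  Base-intersecting {A} (inj₁ fA) (inj₂ smallB) A⊥B =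
    noSmall A (fA , ≤-trans (p⊆q⇒∣p∣≤∣q∣ (Disjoint⇒⊆∁ A⊥B)) smallB)
  Base-intersecting {B = B} (inj₂ smallA) (inj₁ fB) A⊥B =
    noSmall B (fB , ≤-trans (p⊆q⇒∣p∣≤∣q∣ (Disjoint⇒⊆∁ (Disjoint-sym A⊥B))) smallA)
  Base-intersecting {A} (inj₂ smallA) (inj₂ smallB) A⊥B = ≤⇒≯ n≤6 n≥7
    where
    n≤6 : n ≤ 6
    n≤6 = subst (_≤ 6) (∣A∣+∣∁A∣≡n A)
      (+-mono-≤ (≤-trans (p⊆q⇒∣p∣≤∣q∣ (Disjoint⇒⊆∁ A⊥B)) smallB) smallA)

  unique-pure-saturation : (∀ U → ¬ LightSplit f U) → HasUniquePureSaturation f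
  unique-pure-saturation noSplit = g-unique Big⇒2
    where
    open UpClosure fP (Base? f) Base-intersecting (λ base → base) (fromℕ< (≤-trans (s≤s z≤n) n≥7))

    Big⇒2 : ∀ g′ → IsPureSaturation f g′ → ∀ {X} → Big X → g′ X ≡ two
    Big⇒2 g′ pure@((_ , (upward , _) , _) , _) {X} big with Big⇒Up⊎LightSplit big
    ... | inj₁ (Y , baseY , Y⊆X) = upward Y X Y⊆X (Base⇒2 pure baseY)
    ... | inj₂ split             = contradiction split (noSplit X)

  module _ (t : Fin n) (H : (g : Fn n) → IsPureSaturation f g → RecolouredProjection g t) where

    -- Saturate with the complements of the three parts added to Base: the parts stay boolean
    -- and become static, so H pins down their values.
    light-parts-agree : IsPartition3 P Q R → Nonempty P → Nonempty Q → Nonempty R →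
      Light f P → Light f Q → Light f R → f P ≡ iv t P
    light-parts-agree {P} {Q} {R} part P≠∅ Q≠∅ R≠∅ lightP lightQ lightR =
      trans (sym (g-¬Big (¬Big-part (inj₁ refl)))) (H g g-pure P static)
      where
      CoPart = CoParts P Q R

      CoPart-meets-Base : CoPart A → Base f B → ¬ Disjoint A B
      CoPart-meets-Base (inj₁ refl)        = Light-∁-meets-Base lightP
      CoPart-meets-Base (inj₂ (inj₁ refl)) = Light-∁-meets-Base lightQ
      CoPart-meets-Base (inj₂ (inj₂ refl)) = Light-∁-meets-Base lightR

      G : Subset n → Set
      G A = Base f A ⊎ CoPart A

      G? : Decidable G
      G? A = Base? f A ⊎-dec (A ≟ˢ ∁ P ⊎-dec A ≟ˢ ∁ Q ⊎-dec A ≟ˢ ∁ R)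

      G-intersecting : Intersecting G
      G-intersecting (inj₁ baseA) (inj₁ baseB) = Base-intersecting baseA baseB
      G-intersecting (inj₁ baseA) (inj₂ coB)   = CoPart-meets-Base coB baseA ∘ Disjoint-sym
      G-intersecting (inj₂ coA)   (inj₁ baseB) = CoPart-meets-Base coA baseB
      G-intersecting (inj₂ coA)   (inj₂ coB)   = CoParts-intersecting part P≠∅ Q≠∅ R≠∅ coA coB

      open UpClosure fP G? G-intersecting inj₁ t

      ¬Big-part : CoPart (∁ X) → ¬ Big X
      ¬Big-part {X} co big = Big-intersecting big (inj₁ (∁ X , inj₂ co , ⊆-refl)) (Disjoint-∁ {A = X})

      bit-part : CoPart (∁ X) → Bit (g X)
      bit-part co = bit λ gX → ¬Big-part co (g≡2⇒Big gX)

      static : Static g P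
      static = static-of-partition g-polymorphism part Q≠∅ R≠∅
        (bit-part (inj₁ refl)) (bit-part (inj₂ (inj₁ refl))) (bit-part (inj₂ (inj₂ refl)))

    light-split-agrees-whole : LightSplit f U → Nonempty U → f U ≡ iv t U
    light-split-agrees-whole {U} (lightU , light∁U) U≠∅ =
      light-parts-agree (partition-∁∪ U⊥v) U≠∅ (v , x∈⁅x⁆ v) C≠∅
        lightU (Light-⊆ v⊆∁U light∁U) (Light-⊆ C⊆∁U light∁U)
      where
      v = proj₁ (Light⇒Nonempty-∁ lightU)
      v∈∁U = proj₂ (Light⇒Nonempty-∁ lightU)

      v⊆∁U : ⁅ v ⁆ ⊆ ∁ U
      v⊆∁U i∈v rewrite x∈⁅y⁆⇒x≡y v i∈v = v∈∁U

      U⊥v : Disjoint U ⁅ v ⁆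
      U⊥v i∈U i∈v = x∈∁p⇒x∉p (v⊆∁U i∈v) i∈U

      C = ∁ (U ∪ ⁅ v ⁆)

      C⊆∁U : C ⊆ ∁ U
      C⊆∁U = p⊆q⇒∁p⊇∁q (p⊆p∪q ⁅ v ⁆)

      -- ∁ U has at least four elements, so it is not exhausted by v.
      C≠∅ : Nonempty C
      C≠∅ with nonempty? C
      ... | yes C≠∅ = C≠∅
      ... | no C≡∅  = ⊥-elim (≤⇒≯ ∣∁U∣≤1 (≤-trans (s≤s (s≤s z≤n)) (proj₂ lightU)))
        where
        ∁U⊆v : ∁ U ⊆ ⁅ v ⁆
        ∁U⊆v i∈∁U = x∉∁p⇒x∈p λ i∈∁v → C≡∅ (_ , ∈∁∪⁺ (x∈∁p⇒x∉p i∈∁U) (x∈∁p⇒x∉p i∈∁v))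
        ∣∁U∣≤1 : ∣ ∁ U ∣ ≤ 1
        ∣∁U∣≤1 = subst (∣ ∁ U ∣ ≤_) (∣⁅x⁆∣≡1 v) (p⊆q⇒∣p∣≤∣q∣ ∁U⊆v)

    light-split-agrees : LightSplit f U → Nonempty P → P ⊆ U → f P ≡ iv t P
    light-split-agrees {U} {P} split@(lightU , light∁U) P≠∅@(p , p∈P) P⊆U with nonempty? (U ∩ ∁ P)
    ... | no U∖P≡∅ =
      subst (λ X → f X ≡ iv t X) (⊆-antisym U⊆P P⊆U) (light-split-agrees-whole split (p , P⊆U p∈P))
      where
      U⊆P : U ⊆ P
      U⊆P i∈U = x∉∁p⇒x∈p λ i∈∁P → U∖P≡∅ (_ , x∈p∩q⁺ (i∈U , i∈∁P))
    ... | yes U∖P≠∅ =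
      light-parts-agree (partition-∁∪ (Disjoint-∩∁ {A = P} {U})) P≠∅ U∖P≠∅ (v , v∈C)
        (Light-⊆ P⊆U lightU) (Light-⊆ (p∩q⊆p U (∁ P)) lightU) (Light-⊆ C⊆∁U light∁U)
      where
      U∖P = U ∩ ∁ P
      v = proj₁ (Light⇒Nonempty-∁ lightU)
      v∈∁U = proj₂ (Light⇒Nonempty-∁ lightU)

      C⊆∁U : ∁ (P ∪ U∖P) ⊆ ∁ U
      C⊆∁U i∈C = x∉p⇒x∈∁p λ i∈U → i∉U∖P (x∈p∩q⁺ (i∈U , x∉p⇒x∈∁p i∉P))
        where
        i∉P = proj₁ (∈∁∪⁻ i∈C)
        i∉U∖P = proj₂ (∈∁∪⁻ i∈C)

      v∈C : v ∈ ∁ (P ∪ U∖P)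
      v∈C = ∈∁∪⁺ (x∈∁p⇒x∉p v∈∁U ∘ P⊆U) (x∈∁p⇒x∉p v∈∁U ∘ proj₁ ∘ x∈p∩q⁻ U (∁ P))

-- Split S's complement along W; if both pieces are nonempty they fix f S through LO₃,
-- otherwise T lies on one side of W.
agrees-on-one-of-disjoint : ∀ {f : Fn n} {t : Fin n} → IsPolymorphism f →
  (∀ {P} → Nonempty P → P ⊆ W ⊎ P ⊆ ∁ W → f P ≡ iv t P) →
  Disjoint S T → Nonempty T → f S ≢ two → f S ≡ iv t S ⊎ f T ≡ iv t T
agrees-on-one-of-disjoint {W = W} {S} {T} {t = t} fP agrees S⊥T T≠∅ S-boolean
  with nonempty? (W ∩ ∁ S) | nonempty? (∁ (S ∪ (W ∩ ∁ S)))
... | no W∖S≡∅ | _ = inj₂ (agrees T≠∅ (inj₂ T⊆∁W))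
  where
  T⊆∁W : T ⊆ ∁ W
  T⊆∁W i∈T = x∉p⇒x∈∁p λ i∈W → W∖S≡∅ (_ , x∈p∩q⁺ (i∈W , Disjoint⇒⊆∁ (Disjoint-sym S⊥T) i∈T))
... | yes _ | no C≡∅ = inj₂ (agrees T≠∅ (inj₁ T⊆W))
  where
  T⊆W : T ⊆ W
  T⊆W i∈T = x∉∁p⇒x∈p λ i∈∁W →
    C≡∅ (_ , ∈∁∪⁺ (Disjoint-sym S⊥T i∈T) (x∈∁p⇒x∉p i∈∁W ∘ proj₁ ∘ x∈p∩q⁻ W (∁ S)))
... | yes W∖S≠∅ | yes C≠∅ =
  inj₁ (LO3-unique (bit S-boolean) (iv-bit t S) (iv-bit t W∖S) (iv-bit t C) LO3-f LO3-iv)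
  where
  W∖S = W ∩ ∁ S
  C = ∁ (S ∪ W∖S)
  part = partition-∁∪ (Disjoint-∩∁ {A = S} {W})

  C⊆∁W : C ⊆ ∁ W
  C⊆∁W i∈C = x∉p⇒x∈∁p λ i∈W → proj₂ (∈∁∪⁻ i∈C) (x∈p∩q⁺ (i∈W , x∉p⇒x∈∁p (proj₁ (∈∁∪⁻ i∈C))))

  LO3-f = LO3-cong refl (agrees W∖S≠∅ (inj₁ (p∩q⊆p W (∁ S)))) (agrees C≠∅ (inj₂ C⊆∁W))
                        (fP S W∖S C part)
  LO3-iv = iv-polymorphism t S W∖S C part

mainTheorem11 : (n : ℕ) → 7 ≤ n → (f : Fn n) → IsPolymorphism f →
    NoSmall2Sets f → ¬ HasUniquePureSaturation f → (t : Fin n) →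
    ((g : Fn n) → IsPureSaturation f g → RecolouredProjection g t) →
    ¬ (Σ (Subset n) λ S → Σ (Subset n) λ T →
         (S ∩ T ≡ ⊥) × Nonempty S × Nonempty T × Boolean f S × Boolean f T
         × f S ≢ iv t S × f T ≢ iv t T)
mainTheorem11 n n≥7 f fP noSmall notUnique t H (S , T , S∩T≡⊥ , _ , T≠∅ , S-boolean , _ , fS≢ , fT≢)
  with anySubset? (LightSplit? f)
... | no noSplit = notUnique (unique-pure-saturation n≥7 fP noSmall λ U split → noSplit (U , split))
... | yes (W , split) =
  [ fS≢ , fT≢ ]′ (agrees-on-one-of-disjoint fP agrees (∩≡⊥⇒Disjoint S∩T≡⊥) T≠∅ S-boolean)
  where
  agrees : ∀ {P} → Nonempty P → P ⊆ W ⊎ P ⊆ ∁ W → f P ≡ iv t P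
  agrees P≠∅ (inj₁ P⊆W)  = light-split-agrees n≥7 fP noSmall t H split P≠∅ P⊆W
  agrees P≠∅ (inj₂ P⊆∁W) = light-split-agrees n≥7 fP noSmall t H (LightSplit-∁ split) P≠∅ P⊆∁W
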